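{- Let $n,p>0$ be integers and let $A=A^{p+1}_{n+1}$, $\le$, $\odot$, $\sim$ and $\bot$ be as in the context. For all $\langle(m,r),\alpha\rangle,\langle(k,s),\beta\rangle\in A$: $$\langle(m,r),\alpha\rangle\odot\langle(k,s),\beta\rangle=\bot\iff\langle(m,r),\alpha\rangle\le\ \sim\langle(k,s),\beta\rangle.$$
   Context: Fix integers $n,p>0$. On $\mathbb{Z}\times\mathbb{Z}$ use componentwise addition/subtraction and the lexicographic total order $\preccurlyeq$: $(m,r)\preccurlyeq(k,s)$ iff $m<k$, or $m=k$ and $r\le s$; $\max,\min$ are taken with respect to $\preccurlyeq$. For an integer $j\ge 0$ let $L^\omega_{j+1}=\{(m,r)\in\mathbb{Z}^2:(0,0)\preccurlyeq(m,r)\preccurlyeq(j,0)\}$. On $L^\omega_{n+1}$ put $x*y=\max\{(0,0),x+y-(n,0)\}$ and $x\to y=\min\{(n,0),(n,0)-x+y\}$. Let $L_{p+1}=\{0,1,\dots,p\}$ with the usual order and $\alpha*\beta=\max\{0,\alpha+\beta-p\}$. Let $A=A^{p+1}_{n+1}=(L^\omega_{n+1}\times\{0,p\})\cup(L^\omega_{n}\times\{1,\dots,p-1\})$, with elements written $\langle(m,r),\alpha\rangle$; $\bot=\langle(n,0),0\rangle$. Define $\langle(m,r),\alpha\rangle\le\langle(k,s),\beta\rangle$ iff either (o1) $0<\alpha\le\beta$ and $(m,r)\preccurlyeq(k,s)$; or (o2) $\alpha=\beta=0$ and $(k,s)\preccurlyeq(m,r)$; or (o3) $\alpha=0<\beta$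 and $(n-1,0)\preccurlyeq(m+k,r+s)$. Define the commutative operation $\odot$ on $A$, for $a=\langle(m,r),\alpha\rangle$, $b=\langle(k,s),\beta\rangle$: (i) if $\alpha,\beta>0$ and $\alpha*\beta\neq0$: $a\odot b=\langle(m,r)*(k,s),\alpha*\beta\rangle$; (ii) if $\alpha,\beta>0$ and $\alpha*\beta=0$: $a\odot b=\langle\min\{(n,0),(2n-(m+k+1),-(r+s))\},0\rangle$; (iii) if $\alpha>0$, $\beta=0$: $a\odot b=b\odot a=\langle(m,r)\to(k,s),0\rangle$; (iv) if $\alpha=\beta=0$: $a\odot b=\langle\min\{(n,0),(m+k+1,r+s)\},0\rangle$. Define $\sim\langle(m,r),\alpha\rangle=\langle(m,r),p-\alpha\rangle$ if $\alpha\in\{0,p\}$, and $\sim\langle(m,r),\alpha\rangle=\langle(n-1-m,-r),p-\alpha\rangle$ if $\alpha\notin\{0,p\}$. -}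

module Defs where

open import Data.Nat as ℕ using (ℕ; zero; suc; _∸_)
open import Data.Integer as ℤ using (ℤ; +_; -_; _+_; _-_; _<_; _≤_; _<?_; _≤?_)
open import Data.Integer.Properties using (_≟_)
open import Data.Product using (_×_; _,_)
open import Data.Sum using (_⊎_)
open import Relation.Binary.PropositionalEquality using (_≡_)
open import Relation.Nullary using (Dec; yes; no)
open import Relation.Nullary.Decidable using (_⊎-dec_; _×-dec_)

Pt : Set
Pt = ℤ × ℤ

_⊕_ : Pt → Pt → Pt
(m , r) ⊕ (k , s) = (m + k , r + s)

_⊖_ : Pt → Pt → Pt
(m , r) ⊖ (k , s) = (m - k , r - s)

_≼_ : Pt → Pt → Set
(m , r) ≼ (k , s) = (m < k) ⊎ (m ≡ k × r ≤ s)

_≼?_ : (x y : Pt) → Dec (x ≼ y)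
(m , r) ≼? (k , s) = (m <? k) ⊎-dec ((m ≟ k) ×-dec (r ≤? s))

maxL : Pt → Pt → Pt
maxL x y with x ≼? y
... | yes _ = y
... | no  _ = x

minL : Pt → Pt → Pt
minL x y with x ≼? y
... | yes _ = x
... | no  _ = y

pt : ℤ → Pt
pt j = (j , + 0)

-- membership in L^ω_{j+1} = { x : (0,0) ≼ x ≼ (j,0) }
InLω : ℤ → Pt → Set
InLω j x = (pt (+ 0) ≼ x) × (x ≼ pt j)

_*[_]_ : Pt → ℕ → Pt → Pt
x *[ n ] y = maxL (pt (+ 0)) ((x ⊕ y) ⊖ pt (+ n))

_→[_]_ : Pt → ℕ → Pt → Pt
x →[ n ] y = minL (pt (+ n)) ((pt (+ n) ⊖ x) ⊕ y)

-- Łukasiewicz product on L_{p+1} = {0..p}: max{0, α+β-p} (truncated subtraction)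
luk : ℕ → ℕ → ℕ → ℕ
luk p α β = (α ℕ.+ β) ∸ p

record Elem : Set where
  constructor ⟨_,_⟩
  field
    pos : Pt
    lvl : ℕ
open Elem public

InA : ℕ → ℕ → Elem → Set
InA n p ⟨ x , α ⟩ =
  (InLω (+ n) x × (α ≡ 0 ⊎ α ≡ p))
  ⊎ (InLω (+ n - + 1) x × (ℕ._≤_ 1 α × ℕ._≤_ α (p ∸ 1)))

bot : ℕ → Elem
bot n = ⟨ pt (+ n) , 0 ⟩

LeA : ℕ → ℕ → Elem → Elem → Set
LeA n p ⟨ x , α ⟩ ⟨ y , β ⟩ =
    (ℕ._<_ 0 α × ℕ._≤_ α β × x ≼ y)
  ⊎ (α ≡ 0 × β ≡ 0 × y ≼ x)
  ⊎ (α ≡ 0 × ℕ._<_ 0 β × pt (+ n - + 1) ≼ (x ⊕ y))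

odot : ℕ → ℕ → Elem → Elem → Elem
odot n p ⟨ x , suc a ⟩ ⟨ y , suc b ⟩ with luk p (suc a) (suc b)
... | suc c = ⟨ x *[ n ] y , suc c ⟩
... | zero  = ⟨ minL (pt (+ n)) ((ℤ.+ (2 ℕ.* n) - (proj₁' (x ⊕ y) + + 1)) , - proj₂' (x ⊕ y)) , 0 ⟩
  where
  proj₁' : Pt → ℤ
  proj₁' (u , _) = u
  proj₂' : Pt → ℤ
  proj₂' (_ , v) = v
odot n p ⟨ x , suc a ⟩ ⟨ y , zero ⟩ = ⟨ x →[ n ] y , 0 ⟩
odot n p ⟨ x , zero ⟩ ⟨ y , suc b ⟩ = ⟨ y →[ n ] x , 0 ⟩
odot n p ⟨ x , zero ⟩ ⟨ y , zero ⟩ = ⟨ minL (pt (+ n)) ((x ⊕ y) ⊕ pt (+ 1)) , 0 ⟩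

neg : ℕ → ℕ → Elem → Elem
neg n p ⟨ (m , r) , zero ⟩ = ⟨ (m , r) , p ⟩
neg n p ⟨ (m , r) , suc a ⟩ with suc a ℕ.≟ p
... | yes _ = ⟨ (m , r) , 0 ⟩
... | no  _ = ⟨ (+ n - + 1 - m , - r) , p ∸ suc a ⟩

{-# OPTIONS --safe #-}
module Submission where

-- Every product that can equal ⊥ lies on level 0 and has the form ⟨min{(n,0), z}, 0⟩,
-- which is ⊥ exactly when (n,0) ≼ z. Since ≼ is translation invariant, it only depends
-- on differences, so in each case the condition (n,0) ≼ z and the order condition of
-- a ≤ ∼b compare two points of ℤ² with the same difference (a ring identity). On the
-- levels, α * β = 0 iff α ≤ p - β, which is the level condition of the order when ∼
-- moves b to the level p - β; when α > 0 and b is on the top level p, the unit of *,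
-- neither side holds.

open import Defs
open import Data.Nat using (ℕ; _<_)
open import Relation.Binary.PropositionalEquality using (_≡_)
open import Function.Bundles using (_⇔_)

open import Data.Nat as ℕ using (zero; suc; _≤_; _∸_; z≤n)
import Data.Nat.Properties as ℕP
open import Data.Integer as ℤ using (+_; -_)
import Data.Integer.Properties as ℤP
open import Data.Integer.Tactic.RingSolver using (solve)
open import Data.List using ([]; _∷_)
open import Data.Product using (_×_; _,_; proj₁; proj₂)
open import Data.Product.Function.NonDependent.Propositional using (_×-⇔_)
open import Data.Sum using (inj₁; inj₂)
open import Function.Base using (_∘_)
open import Function.Bundles using (mk⇔; Equivalence)
import Function.Properties.Equivalence as ⇔
open import Relation.Binary.PropositionalEquality
  using (refl; sym; trans; cong; cong₂; subst₂; _≢_; module ≡-Reasoning)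
open import Relation.Nullary using (yes; no; contradiction)

open Equivalence using (to)

-- the position part of ∼ on the levels 1, …, p - 1
reflect : ℕ → Pt → Pt
reflect n (k , s) = (+ n ℤ.- + 1 ℤ.- k , - s)

≼-refl : ∀ x → x ≼ x
≼-refl _ = inj₂ (refl , ℤP.≤-refl)

≼-⊕ʳ : ∀ t {x y} → x ≼ y → (x ⊕ t) ≼ (y ⊕ t)
≼-⊕ʳ (c , d) (inj₁ m<k) = inj₁ (ℤP.+-monoˡ-< c m<k)
≼-⊕ʳ (c , d) (inj₂ (refl , r≤s)) = inj₂ (refl , ℤP.+-monoˡ-≤ d r≤s)

i+[j-i]≡j : ∀ a a′ → a ℤ.+ (a′ ℤ.- a) ≡ a′
i+[j-i]≡j a a′ = solve (a ∷ a′ ∷ [])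

j-i≡l-k⇒j+[k-i]≡l : ∀ {a b a′ b′} → b ℤ.- a ≡ b′ ℤ.- a′ → b ℤ.+ (a′ ℤ.- a) ≡ b′
j-i≡l-k⇒j+[k-i]≡l {a} {b} {a′} {b′} d = begin
  b ℤ.+ (a′ ℤ.- a)    ≡⟨ solve (a ∷ b ∷ a′ ∷ []) ⟩
  (b ℤ.- a) ℤ.+ a′    ≡⟨ cong (ℤ._+ a′) d ⟩
  (b′ ℤ.- a′) ℤ.+ a′  ≡⟨ solve (a′ ∷ b′ ∷ []) ⟩
  b′                  ∎
  where open ≡-Reasoning

≼-transfer : ∀ {x y x′ y′} → y ⊖ x ≡ y′ ⊖ x′ → x ≼ y → x′ ≼ y′
≼-transfer {m , r} {k , s} {m′ , r′} {k′ , s′} d =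
  subst₂ _≼_ (cong₂ _,_ (i+[j-i]≡j m m′) (i+[j-i]≡j r r′))
             (cong₂ _,_ (j-i≡l-k⇒j+[k-i]≡l {m} {k} (cong proj₁ d)) (j-i≡l-k⇒j+[k-i]≡l {r} {s} (cong proj₂ d)))
  ∘ ≼-⊕ʳ (m′ ℤ.- m , r′ ℤ.- r)

≼-by-difference : ∀ {x y x′ y′} → y ⊖ x ≡ y′ ⊖ x′ → x ≼ y ⇔ x′ ≼ y′
≼-by-difference d = mk⇔ (≼-transfer d) (≼-transfer (sym d))

minL-≡ˡ⇔≼ : ∀ c z → (minL c z ≡ c) ⇔ c ≼ z
minL-≡ˡ⇔≼ c z with c ≼? z
... | yes c≼z = mk⇔ (λ _ → c≼z) (λ _ → refl)
... | no  c⋠z = mk⇔ (λ z≡c → contradiction (subst₂ _≼_ refl (sym z≡c) (≼-refl c)) c⋠z)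
                    (λ c≼z → contradiction c≼z c⋠z)

truncated≡bot⇔ : ∀ n z → (⟨ minL (pt (+ n)) z , 0 ⟩ ≡ bot n) ⇔ pt (+ n) ≼ z
truncated≡bot⇔ n z =
  ⇔.trans (mk⇔ (cong pos) (cong ⟨_, 0 ⟩)) (minL-≡ˡ⇔≼ (pt (+ n)) z)

pos-double : ∀ n → + (2 ℕ.* n) ≡ + n ℤ.+ + n
pos-double n = trans (ℤP.pos-* 2 n) (twice (+ n))
  where
  twice : ∀ c → + 2 ℤ.* c ≡ c ℤ.+ c
  twice c = solve (c ∷ [])

⊙₀₀≡bot⇔ : ∀ n p x y → (odot n p ⟨ x , 0 ⟩ ⟨ y , 0 ⟩ ≡ bot n) ⇔ pt (+ n ℤ.- + 1) ≼ (x ⊕ y)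
⊙₀₀≡bot⇔ n p (m , r) (k , s) =
  ⇔.trans (truncated≡bot⇔ n _) (≼-by-difference (difference (+ n)))
  where
  difference : ∀ c → (m ℤ.+ k ℤ.+ + 1 ℤ.- c , r ℤ.+ s ℤ.+ + 0 ℤ.- + 0)
                     ≡ (m ℤ.+ k ℤ.- (c ℤ.- + 1) , r ℤ.+ s ℤ.- + 0)
  difference c = cong₂ _,_ (solve (m ∷ k ∷ c ∷ [])) (solve (r ∷ s ∷ []))

⊙₊₀≡bot⇔ : ∀ n p x y a → (odot n p ⟨ x , suc a ⟩ ⟨ y , 0 ⟩ ≡ bot n) ⇔ x ≼ y
⊙₊₀≡bot⇔ n p (m , r) (k , s) a =
  ⇔.trans (truncated≡bot⇔ n _) (≼-by-difference (difference (+ n)))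
  where
  difference : ∀ c → (c ℤ.- m ℤ.+ k ℤ.- c , + 0 ℤ.- r ℤ.+ s ℤ.- + 0) ≡ (k ℤ.- m , s ℤ.- r)
  difference c = cong₂ _,_ (solve (m ∷ k ∷ c ∷ [])) (solve (r ∷ s ∷ []))

⊙₀₊≡bot⇔ : ∀ n p x y b → (odot n p ⟨ x , 0 ⟩ ⟨ y , suc b ⟩ ≡ bot n) ⇔ y ≼ x
⊙₀₊≡bot⇔ n p x y b = ⊙₊₀≡bot⇔ n p y x b

⊙₊₊≡bot⇔ : ∀ n p x y a b →
  (odot n p ⟨ x , suc a ⟩ ⟨ y , suc b ⟩ ≡ bot n) ⇔ (luk p (suc a) (suc b) ≡ 0 × x ≼ reflect n y)
⊙₊₊≡bot⇔ n p (m , r) (k , s) a b with luk p (suc a) (suc b)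
... | suc _ = mk⇔ (λ ()) (λ ())
... | zero  = ⇔.trans (truncated≡bot⇔ n _)
                      (⇔.trans (≼-by-difference (difference (+ n) _ (pos-double n)))
                               (mk⇔ (refl ,_) proj₂))
  where
  difference : ∀ c d → d ≡ c ℤ.+ c →
    (d ℤ.- (m ℤ.+ k ℤ.+ + 1) ℤ.- c , - (r ℤ.+ s) ℤ.- + 0) ≡ (c ℤ.- + 1 ℤ.- k ℤ.- m , - s ℤ.- r)
  difference c _ refl = cong₂ _,_ (solve (c ∷ m ∷ k ∷ [])) (solve (r ∷ s ∷ []))

≼⇔≼-⊕reflect : ∀ n x y → y ≼ x ⇔ pt (+ n ℤ.- + 1) ≼ (x ⊕ reflect n y)
≼⇔≼-⊕reflect n (m , r) (k , s) = ≼-by-difference (difference (+ n))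
  where
  difference : ∀ c → (m ℤ.- k , r ℤ.- s)
                     ≡ (m ℤ.+ (c ℤ.- + 1 ℤ.- k) ℤ.- (c ℤ.- + 1) , r ℤ.+ - s ℤ.- + 0)
  difference c = cong₂ _,_ (solve (m ∷ k ∷ c ∷ [])) (solve (r ∷ s ∷ []))

luk-identityʳ : ∀ p α → luk p α p ≡ α
luk-identityʳ p α = ℕP.m+n∸n≡m α p

luk≡0⇔≤∸ : ∀ {p} α β → β ≤ p → (luk p α β ≡ 0) ⇔ α ≤ p ∸ β
luk≡0⇔≤∸ {p} α β β≤p = mk⇔ (ℕP.m+n≤o⇒m≤o∸n α ∘ ℕP.m∸n≡0⇒m≤n {α ℕ.+ β} {p})
                           (ℕP.m≤n⇒m∸n≡0 ∘ ℕP.m≤o∸n⇒m+n≤o α β≤p)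

InA⇒lvl≤ : ∀ {n p x α} → InA n p ⟨ x , α ⟩ → α ≤ p
InA⇒lvl≤ (inj₁ (_ , inj₁ refl)) = z≤n
InA⇒lvl≤ (inj₁ (_ , inj₂ refl)) = ℕP.≤-refl
InA⇒lvl≤ {p = p} (inj₂ (_ , _ , α≤p-1)) = ℕP.≤-trans α≤p-1 (ℕP.m∸n≤m p 1)

LeA-pos⇔ : ∀ n p {x y a β} → LeA n p ⟨ x , suc a ⟩ ⟨ y , β ⟩ ⇔ (suc a ≤ β × x ≼ y)
LeA-pos⇔ n p = mk⇔
  (λ { (inj₁ (_ , α≤β , x≼y)) → α≤β , x≼y ; (inj₂ (inj₁ (() , _))) ; (inj₂ (inj₂ (() , _))) })
  (λ (α≤β , x≼y) → inj₁ (ℕ.s≤s z≤n , α≤β , x≼y))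

LeA-zero-zero⇔ : ∀ n p {x y} → LeA n p ⟨ x , 0 ⟩ ⟨ y , 0 ⟩ ⇔ y ≼ x
LeA-zero-zero⇔ n p = mk⇔
  (λ { (inj₁ (() , _)) ; (inj₂ (inj₁ (_ , _ , y≼x))) → y≼x ; (inj₂ (inj₂ (_ , () , _))) })
  (λ y≼x → inj₂ (inj₁ (refl , refl , y≼x)))

LeA-zero-pos⇔ : ∀ n p {x y β} → 0 < β → LeA n p ⟨ x , 0 ⟩ ⟨ y , β ⟩ ⇔ pt (+ n ℤ.- + 1) ≼ (x ⊕ y)
LeA-zero-pos⇔ n p 0<β = mk⇔
  (λ { (inj₁ (() , _))
      ; (inj₂ (inj₁ (_ , β≡0 , _))) → contradiction (sym β≡0) (ℕP.<⇒≢ 0<β)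
      ; (inj₂ (inj₂ (_ , _ , h))) → h })
  (λ h → inj₂ (inj₂ (refl , 0<β , h)))

lemma2p4 : (n p : ℕ) → 0 < n → 0 < p → (a b : Elem) → InA n p a → InA n p b →
    (odot n p a b ≡ bot n) ⇔ LeA n p a (neg n p b)
lemma2p4 n p _ 0<p ⟨ x , zero ⟩ ⟨ y@(_ , _) , zero ⟩ _ _ =
  ⇔.trans (⊙₀₀≡bot⇔ n p x y) (⇔.sym (LeA-zero-pos⇔ n p 0<p))
lemma2p4 n p _ _ ⟨ x , suc a ⟩ ⟨ y@(_ , _) , zero ⟩ a∈A _ =
  ⇔.trans (⊙₊₀≡bot⇔ n p x y a) (⇔.sym (⇔.trans (LeA-pos⇔ n p) (mk⇔ proj₂ (InA⇒lvl≤ a∈A ,_))))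
lemma2p4 n p _ _ ⟨ x , zero ⟩ ⟨ y@(_ , _) , suc b ⟩ _ b∈A with suc b ℕ.≟ p
... | yes _   = ⇔.trans (⊙₀₊≡bot⇔ n p x y b) (⇔.sym (LeA-zero-zero⇔ n p))
... | no  b≢p = ⇔.trans (⊙₀₊≡bot⇔ n p x y b)
                  (⇔.trans (≼⇔≼-⊕reflect n x y) (⇔.sym (LeA-zero-pos⇔ n p 0<p∸b)))
  where
  0<p∸b : 0 < p ∸ suc b
  0<p∸b = ℕP.m<n⇒0<n∸m (ℕP.≤∧≢⇒< (InA⇒lvl≤ b∈A) b≢p)
lemma2p4 n p _ _ ⟨ x , suc a ⟩ ⟨ y@(_ , _) , suc b ⟩ _ b∈A with suc b ℕ.≟ p
... | yes refl = mk⇔ (λ ⊙≡bot → contradiction (proj₁ (to (⊙₊₊≡bot⇔ n p x y a b) ⊙≡bot)) luk≢0)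
                     (λ ≤∼b → contradiction (proj₁ (to (LeA-pos⇔ n p) ≤∼b)) λ ())
  where
  luk≢0 : luk p (suc a) p ≢ 0
  luk≢0 rewrite luk-identityʳ p (suc a) = λ ()
... | no _     = ⇔.trans (⊙₊₊≡bot⇔ n p x y a b)
                   (⇔.trans (luk≡0⇔≤∸ (suc a) (suc b) (InA⇒lvl≤ b∈A) ×-⇔ ⇔.refl) (⇔.sym (LeA-pos⇔ n p)))
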